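{- Let $n\geq 1$ and let $e=e_1\cdots e_n\in\mathbf{I}_n(110,210)$. Define $\alpha(e)=t_1\cdots t_n$ by $t_j=\max\{e_1,\dots,e_j\}$ if $e_j=e_k$ for some $k>j$, and $t_j=e_j$ otherwise. Then $\mathrm{Asc}(e)=\mathrm{Asc}(\alpha(e))$.
   Context: An inversion sequence of length $n$ is a word $e=e_1\cdots e_n$ of nonnegative integers with $0\leq e_i\leq i-1$ for all $i\in[n]$; $\mathbf{I}_n$ denotes the set of them. A word $w$ contains the pattern $p=p_1p_2p_3$ if some subsequence $w_iw_jw_k$ ($i<j<k$) is order isomorphic to $p$ (i.e., $w_a<w_b\iff p_a<p_b$ and $w_a=w_b\iff p_a=p_b$ for corresponding positions); otherwise it avoids $p$. $\mathbf{I}_n(110,210)$ is the set of $e\in\mathbf{I}_n$ avoiding both $110$ and $210$. $\mathrm{Asc}(w)=\{i\in[n-1]:w_i<w_{i+1}\}$. -}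

module Defs where

open import Data.Nat using (ℕ; zero; suc; _<_; _≤_; _⊔_)
open import Data.Fin using (Fin; toℕ; inject₁)
import Data.Fin as F
open import Data.List using (List; []; _∷_; map; foldr; filter)
open import Data.Fin.Base using () renaming (_≤_ to _≤ᶠ_; _<_ to _<ᶠ_)
open import Data.Fin.Properties using (any?) renaming (_≤?_ to _≤ᶠ?_; _<?_ to _<ᶠ?_)
open import Data.Nat.Properties using (_≟_)
open import Relation.Nullary.Decidable using (_×-dec_)
open import Data.List using (allFin)
open import Data.Product using (Σ; ∃; _×_; _,_)
open import Relation.Binary.PropositionalEquality using (_≡_)
open import Relation.Nullary using (¬_; Dec; yes; no)
open import Function.Bundles using (_⇔_)

Word : ℕ → Set
Word n = Fin n → ℕ

-- Inversion sequence: e_i ≤ i - 1 for 1-indexed i, i.e. e i ≤ toℕ i for 0-indexed i.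
IsInversionSeq : {n : ℕ} → Word n → Set
IsInversionSeq {n} e = (i : Fin n) → e i ≤ toℕ i

SameOrder : ℕ → ℕ → ℕ → ℕ → Set
SameOrder a b x y = ((a < b) ⇔ (x < y)) × ((a ≡ b) ⇔ (x ≡ y))

Contains3 : {n : ℕ} → Word n → ℕ → ℕ → ℕ → Set
Contains3 {n} w p₁ p₂ p₃ =
  Σ (Fin n) λ i → Σ (Fin n) λ j → Σ (Fin n) λ k →
    (i <ᶠ j) × (j <ᶠ k) ×
    SameOrder (w i) (w j) p₁ p₂ × SameOrder (w j) (w k) p₂ p₃ ×
    SameOrder (w i) (w k) p₁ p₃

Avoids3 : {n : ℕ} → Word n → ℕ → ℕ → ℕ → Set
Avoids3 w p₁ p₂ p₃ = ¬ Contains3 w p₁ p₂ p₃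

InI110-210 : {n : ℕ} → Word n → Set
InI110-210 e = IsInversionSeq e × Avoids3 e 1 1 0 × Avoids3 e 2 1 0

prefixMax : {n : ℕ} → Word n → Fin n → ℕ
prefixMax w j = foldr _⊔_ 0 (map w (filter (λ k → k ≤ᶠ? j) (allFin _)))

repeatsLater : {n : ℕ} → Word n → Fin n → Set
repeatsLater {n} e j = Σ (Fin n) λ k → (j <ᶠ k) × (e j ≡ e k)

repeatsLater? : {n : ℕ} → (e : Word n) → (j : Fin n) → Dec (repeatsLater e j)
repeatsLater? {n} e j = any? (λ k → (j <ᶠ? k) ×-dec (e j ≟ e k))

α : {n : ℕ} → Word n → Word n
α e j with repeatsLater? e j
... | yes _ = prefixMax e j
... | no  _ = e j

-- i ∈ Asc(w), for a word of length suc m; ascent positions are i : Fin m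
-- (0-indexed i means 1-indexed position i+1), comparing w_i with w_{i+1}.
IsAsc : {m : ℕ} → Word (suc m) → Fin m → Set
IsAsc w i = w (inject₁ i) < w (F.suc i)

-- In a word avoiding 110 and 210, a letter followed later by a strictly smaller one exceeds
-- every letter before it.  Hence if e_j < e_{j+1} and e_j repeats later, that later copy lies
-- after j+1 and is below e_{j+1}, so max(e_1,…,e_j) < e_{j+1}: raising t_j to the prefix
-- maximum keeps the ascent.  Conversely if e_{j+1} ≤ e_j then t_{j+1} ≤ t_j: either e_j repeats
-- (t_j is already the maximum up to j), or e_j does not, in which case e_{j+1} < e_j and the
-- same fact bounds everything before j+1 by e_j.
module Submission where

open import Defs
open import Data.Nat using (ℕ; zero; suc; _≤_; _<_; _⊔_; z≤n; s≤s; s≤s⁻¹; z<s; s<s)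
open import Data.Nat.Properties
open import Data.Fin using (Fin; inject₁) renaming (suc to fsuc)
open import Data.Fin.Base using () renaming (_≤_ to _≤ᶠ_; _<_ to _<ᶠ_)
import Data.Fin.Properties as Fin
open import Data.List using (List; map; filter; allFin)
open import Data.List.Properties using (foldr-preservesᵇ; foldr-forcesᵇ)
open import Data.List.Relation.Unary.All as All using (All)
open import Data.List.Relation.Unary.All.Properties using (all-filter; map⁺; map⁻)
open import Data.List.Membership.Propositional.Properties using (∈-filter⁺; ∈-allFin)
open import Data.Product using (_×_; _,_)
open import Data.Sum using (_⊎_; inj₁; inj₂)
open import Relation.Binary using (tri<; tri≈; tri>)
open import Relation.Nullary using (yes; no; contradiction)
open import Relation.Binary.PropositionalEquality using (_≡_; refl; sym; cong; subst)
open import Function.Bundles using (_⇔_; mk⇔)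

module _ {n : ℕ} (e : Word n) (j : Fin n) where

  private
    prefix : List (Fin n)
    prefix = filter (λ k → k Fin.≤? j) (allFin n)

  prefixMax-lub : ∀ {x} → (∀ k → k ≤ᶠ j → e k ≤ x) → prefixMax e j ≤ x
  prefixMax-lub {x} bound = foldr-preservesᵇ {P = _≤ x} ⊔-lub z≤n
    (map⁺ (All.map (bound _) (all-filter (λ k → k Fin.≤? j) (allFin n))))

  prefixMax-<-lub : ∀ {x} → (∀ k → k ≤ᶠ j → e k < x) → prefixMax e j < x
  prefixMax-<-lub {zero}  bound = contradiction (bound j Fin.≤-refl) λ ()
  prefixMax-<-lub {suc x} bound = s≤s (prefixMax-lub (λ k k≤j → s≤s⁻¹ (bound k k≤j)))

  ≤-prefixMax : ∀ {k} → k ≤ᶠ j → e k ≤ prefixMax e j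
  ≤-prefixMax {k} k≤j = All.lookup bounded (∈-filter⁺ (λ k → k Fin.≤? j) (∈-allFin k) k≤j)
    where
    split-⊔ : ∀ a b → a ⊔ b ≤ prefixMax e j → a ≤ prefixMax e j × b ≤ prefixMax e j
    split-⊔ a b a⊔b≤ = m⊔n≤o⇒m≤o a b a⊔b≤ , m⊔n≤o⇒n≤o a b a⊔b≤
    bounded : All (λ k → e k ≤ prefixMax e j) prefix
    bounded = map⁻ (foldr-forcesᵇ split-⊔ 0 (map e prefix) ≤-refl)

≤-α : ∀ {n} (e : Word n) j → e j ≤ α e j
≤-α e j with repeatsLater? e j
... | yes _ = ≤-prefixMax e j ≤-refl
... | no  _ = ≤-refl

module _ {m : ℕ} (i : Fin m) where

  inject₁<suc : inject₁ i <ᶠ fsuc i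
  inject₁<suc = Fin.≤̄⇒inject₁< ≤-refl

  ≤suc⇒≤inject₁⊎≡suc : ∀ {k} → k ≤ᶠ fsuc i → k ≤ᶠ inject₁ i ⊎ k ≡ fsuc i
  ≤suc⇒≤inject₁⊎≡suc k≤ with m≤n⇒m<n∨m≡n k≤
  ... | inj₁ k< = inj₁ (Fin.<⇒≤pred k<)
  ... | inj₂ k≡ = inj₂ (Fin.toℕ-injective k≡)

  inject₁<⇒suc≤ : ∀ {k : Fin (suc m)} → inject₁ i <ᶠ k → fsuc i ≤ᶠ k
  inject₁<⇒suc≤ i<k rewrite sym (Fin.toℕ-inject₁ i) = i<k

  prefixMax-lub-suc : ∀ (e : Word (suc m)) {x} → prefixMax e (inject₁ i) ≤ x →
                      e (fsuc i) ≤ x → prefixMax e (fsuc i) ≤ x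
  prefixMax-lub-suc e {x} max≤x last≤x = prefixMax-lub e (fsuc i) bound
    where
    bound : ∀ k → k ≤ᶠ fsuc i → e k ≤ x
    bound k k≤ with ≤suc⇒≤inject₁⊎≡suc k≤
    ... | inj₁ k≤i  = ≤-trans (≤-prefixMax e (inject₁ i) k≤i) max≤x
    ... | inj₂ refl = last≤x

sameOrder-> : ∀ {a b x y} → b < a → y < x → SameOrder a b x y
sameOrder-> b<a y<x =
    mk⇔ (λ a<b → contradiction b<a (<-asym a<b)) (λ x<y → contradiction y<x (<-asym x<y))
  , mk⇔ (λ { refl → contradiction b<a (<-irrefl refl) })
        (λ { refl → contradiction y<x (<-irrefl refl) })

sameOrder-≡ : ∀ {a b x y} → a ≡ b → x ≡ y → SameOrder a b x y
sameOrder-≡ refl refl = mk⇔ (λ a<a → contradiction a<a (<-irrefl refl))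
                         (λ x<x → contradiction x<x (<-irrefl refl))
                   , mk⇔ (λ _ → refl) (λ _ → refl)

<-before-descent : ∀ {n} {e : Word n} → Avoids3 e 1 1 0 → Avoids3 e 2 1 0 →
                   ∀ {p q r} → p <ᶠ q → q <ᶠ r → e r < e q → e p < e q
<-before-descent {e = e} avoid110 avoid210 {p} {q} {r} p<q q<r r<q with <-cmp (e p) (e q)
... | tri< ep<eq _ _ = ep<eq
... | tri≈ _ ep≡eq _ = contradiction
  (p , q , r , p<q , q<r , sameOrder-≡ ep≡eq refl , sameOrder-> r<q z<s ,
   sameOrder-> (subst (e r <_) (sym ep≡eq) r<q) z<s) avoid110
... | tri> _ _ eq<ep = contradiction
  (p , q , r , p<q , q<r , sameOrder-> eq<ep (s<s z<s) , sameOrder-> r<q z<s ,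
   sameOrder-> (<-trans r<q eq<ep) z<s) avoid210

≤-before-descent : ∀ {n} {e : Word n} → Avoids3 e 1 1 0 → Avoids3 e 2 1 0 →
                   ∀ {p q r} → p ≤ᶠ q → q <ᶠ r → e r < e q → e p ≤ e q
≤-before-descent {e = e} avoid110 avoid210 p≤q q<r r<q with m≤n⇒m<n∨m≡n p≤q
... | inj₁ p<q = <⇒≤ (<-before-descent avoid110 avoid210 p<q q<r r<q)
... | inj₂ p≡q = ≤-reflexive (cong e (Fin.toℕ-injective p≡q))

module _ {m : ℕ} {e : Word (suc m)} (avoid110 : Avoids3 e 1 1 0) (avoid210 : Avoids3 e 2 1 0)
         (i : Fin m) where

  α-ascent : e (inject₁ i) < e (fsuc i) → α e (inject₁ i) < α e (fsuc i)
  α-ascent ascent with repeatsLater? e (inject₁ i)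
  ... | no  _ = <-≤-trans ascent (≤-α e (fsuc i))
  ... | yes (k , i<k , ei≡ek) = <-≤-trans prefix<next (≤-α e (fsuc i))
    where
    next<k : fsuc i <ᶠ k
    next<k = Fin.≤∧≢⇒< (inject₁<⇒suc≤ i i<k)
               (λ { refl → <⇒≢ ascent ei≡ek })
    prefix<next : prefixMax e (inject₁ i) < e (fsuc i)
    prefix<next = prefixMax-<-lub e (inject₁ i) λ p p≤i →
      <-before-descent avoid110 avoid210 (≤-<-trans p≤i (inject₁<suc i)) next<k
        (subst (_< e (fsuc i)) ei≡ek ascent)

  α-nonascent : e (fsuc i) ≤ e (inject₁ i) → α e (fsuc i) ≤ α e (inject₁ i)
  α-nonascent nonascent with repeatsLater? e (fsuc i)
  ... | no  _ = ≤-trans nonascent (≤-α e (inject₁ i))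
  ... | yes _ with repeatsLater? e (inject₁ i)
  ...   | yes _ =
    prefixMax-lub-suc i e ≤-refl (≤-trans nonascent (≤-prefixMax e (inject₁ i) Fin.≤-refl))
  ...   | no unrepeated = prefixMax-lub-suc i e
    (prefixMax-lub e (inject₁ i) λ k k≤i →
      ≤-before-descent avoid110 avoid210 k≤i (inject₁<suc i) descent)
    nonascent
    where
    descent : e (fsuc i) < e (inject₁ i)
    descent = ≤∧≢⇒< nonascent λ eb≡ea → unrepeated (fsuc i , inject₁<suc i , sym eb≡ea)

lemma2p1 : (m : ℕ) (e : Word (suc m)) → InI110-210 e →
    (i : Fin m) → IsAsc e i ⇔ IsAsc (α e) i
lemma2p1 m e (_ , avoid110 , avoid210) i = mk⇔ (α-ascent avoid110 avoid210 i) reflect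
  where
  reflect : IsAsc (α e) i → IsAsc e i
  reflect α-asc with e (inject₁ i) <? e (fsuc i)
  ... | yes asc   = asc
  ... | no  ¬asc  = contradiction α-asc (≤⇒≯ (α-nonascent avoid110 avoid210 i (≮⇒≥ ¬asc)))
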